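{- Let $M\in\mathbb{Z}^{\ell\times m}$ have full column rank and $F\in\mathbb{Z}^{n\times m}$. If $H_1,H_2\in\mathbb{Z}^{n\times n}$ are nonsingular with $H_2H_1$ a basis of $\mathcal{R}(M,F)$, then (1) $H_1$ is a basis of $\mathcal{R}\left( \begin{bmatrix} M \\ H_1 F \end{bmatrix}, F \right)$; (2) $H_2$ is a basis of $\mathcal{R}(M,H_1F)$.
   Context: For an integer matrix $M$ of full column rank and $F\in\mathbb{Z}^{n\times m}$ with the same number of columns, $\mathcal{R}(M,F)=\{p\in\mathbb{Z}^{1\times n} : pF=qM\text{ for some integer row vector } q\}$. A basis of $\mathcal{R}(M,F)$ is a nonsingular $P\in\mathbb{Z}^{n\times n}$ whose rows generate $\mathcal{R}(M,F)$ over $\mathbb{Z}$. -}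

module Defs where

open import Data.Nat using (ℕ; zero; suc)
import Data.Nat
import Data.Fin
open import Data.Fin using (Fin; zero; suc; punchIn)
open import Data.Integer using (ℤ; _+_; _*_; -_; 0ℤ; 1ℤ)
open import Data.Vec.Functional using (Vector; _++_)
open import Data.Product using (Σ; _×_)
open import Relation.Binary.PropositionalEquality using (_≡_)
open import Relation.Nullary using (¬_)

Mat : ℕ → ℕ → Set
Mat r c = Fin r → Fin c → ℤ

Row : ℕ → Set
Row n = Fin n → ℤ

Σℤ : ∀ {n} → (Fin n → ℤ) → ℤ
Σℤ {zero}  f = 0ℤ
Σℤ {suc n} f = f zero + Σℤ (λ i → f (suc i))

_⊗_ : ∀ {r k c} → Mat r k → Mat k c → Mat r c
(A ⊗ B) i j = Σℤ (λ t → A i t * B t j)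

_⊙_ : ∀ {k c} → Row k → Mat k c → Row c
(p ⊙ B) j = Σℤ (λ t → p t * B t j)

_·col_ : ∀ {r c} → Mat r c → (Fin c → ℤ) → (Fin r → ℤ)
(A ·col x) i = Σℤ (λ t → A i t * x t)

_≋_ : ∀ {n} → (Fin n → ℤ) → (Fin n → ℤ) → Set
u ≋ v = ∀ i → u i ≡ v i

zeroVec : ∀ {n} → Fin n → ℤ
zeroVec _ = 0ℤ

stack : ∀ {r s c} → Mat r c → Mat s c → Mat (r Data.Nat.+ s) c
stack A B = A ++ B

sign : ℕ → ℤ
sign zero = 1ℤ
sign (suc zero) = - 1ℤ
sign (suc (suc k)) = sign k

det : ∀ {n} → Mat n n → ℤ
det {zero}  A = 1ℤ
det {suc n} A = Σℤ (λ j → sign (Data.Fin.toℕ j) * (A zero j * det (λ i k → A (suc i) (punchIn j k))))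

Nonsingular : ∀ {n} → Mat n n → Set
Nonsingular A = ¬ (det A ≡ 0ℤ)

FullColumnRank : ∀ {ℓ m} → Mat ℓ m → Set
FullColumnRank M = ∀ x → (M ·col x) ≋ zeroVec → x ≋ zeroVec

InR : ∀ {ℓ n m} → Mat ℓ m → Mat n m → Row n → Set
InR {ℓ} M F p = Σ (Row ℓ) (λ q → (p ⊙ F) ≋ (q ⊙ M))

InRowLattice : ∀ {n} → Mat n n → Row n → Set
InRowLattice {n} P p = Σ (Row n) (λ u → p ≋ (u ⊙ P))

IsBasisR : ∀ {ℓ n m} → Mat ℓ m → Mat n m → Mat n n → Set
IsBasisR M F P = Nonsingular P ×
  (∀ p → (InR M F p → InRowLattice P p) × (InRowLattice P p → InR M F p))

-- Both parts only rearrange the defining relation p F = q M: row-times-matrix products are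
-- associative, and a row q = (q₁ , q₂) against the stacked matrix [M ; H₁ F] gives q₁ M + q₂ H₁ F.
-- For (1), p − q₂ H₁ then lies in R(M,F), i.e. in the row lattice of H₂ H₁, which is contained in
-- that of H₁.  For (2), p ∈ R(M, H₁ F) iff p H₁ ∈ R(M,F) = rows of H₂ H₁, and H₁ cancels on the right.
--
-- That cancellation is the one real input: a nonsingular matrix has trivial left kernel.  For the
-- first-row Laplace expansion defining det, expanding along the first two rows and peeling off one
-- column at a time shows that det changes sign when these rows are swapped.  Hence a repeated row
-- forces det = 0, so x A = 0 gives x₀ · det A = 0 by cofactor expansion, and induction on the minors
-- disposes of the remaining coordinates of x.
{-# OPTIONS --safe #-}
module Submission where

open import Defs
open import Data.Nat using (ℕ)
open import Data.Product using (_×_)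

open import Data.Nat as ℕ using (zero; suc)
open import Data.Fin using (Fin; zero; suc; punchIn; toℕ; lift; _↑ˡ_; _↑ʳ_)
open import Data.Integer using (ℤ; +0; +[1+_]; -[1+_]; _+_; _*_; -_; _-_; 0ℤ; 1ℤ)
open import Data.Integer.Properties
  using (_≟_; +-identityˡ; +-identityʳ; +-assoc; *-identityˡ; *-zeroʳ; *-assoc; *-comm;
         *-distribˡ-+; *-distribʳ-+; neg-distrib-+; neg-distribˡ-*;
         i*j≡0⇒i≡0∨j≡0; i-j≡0⇒i≡j; i≡j⇒i-j≡0)
open import Data.Integer.Tactic.RingSolver using (solve-∀)
open import Data.Vec.Functional using (_++_; _∷_; tail)
open import Data.Vec.Functional.Properties using (lookup-++ˡ; lookup-++ʳ)
open import Data.Product using (Σ; _,_; proj₁; proj₂)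
open import Data.Sum using (inj₁; inj₂)
open import Function using (_∘_; _⇔_; mk⇔; Equivalence)
open import Function.Construct.Composition using (_⇔-∘_)
open import Relation.Binary.Core using (_Preserves_⟶_)
open import Relation.Nullary using (contradiction)
open import Relation.Nullary.Decidable using (decidable-stable)
open import Relation.Binary.PropositionalEquality
open ≡-Reasoning

private
  variable
    k ℓ m n : ℕ

Σℤ-cong : {f g : Fin n → ℤ} → f ≋ g → Σℤ f ≡ Σℤ g
Σℤ-cong {zero}  f≋g = refl
Σℤ-cong {suc n} f≋g = cong₂ _+_ (f≋g zero) (Σℤ-cong (f≋g ∘ suc))

Σℤ-zero : {f : Fin n → ℤ} → f ≋ zeroVec → Σℤ f ≡ 0ℤ
Σℤ-zero {zero}  f≋0 = refl
Σℤ-zero {suc n} f≋0 = cong₂ _+_ (f≋0 zero) (Σℤ-zero (f≋0 ∘ suc))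

Σℤ-distrib-+ : (f g : Fin n → ℤ) → Σℤ (λ i → f i + g i) ≡ Σℤ f + Σℤ g
Σℤ-distrib-+ {zero}  f g = refl
Σℤ-distrib-+ {suc n} f g =
  trans (cong (f zero + g zero +_) (Σℤ-distrib-+ (f ∘ suc) (g ∘ suc)))
        (interchange (f zero) (g zero) _ _)
  where
  interchange : ∀ a b c d → (a + b) + (c + d) ≡ (a + c) + (b + d)
  interchange = solve-∀

neg-distrib-Σℤ : (f : Fin n → ℤ) → - Σℤ f ≡ Σℤ (λ i → - f i)
neg-distrib-Σℤ {zero}  f = refl
neg-distrib-Σℤ {suc n} f =
  trans (neg-distrib-+ (f zero) _) (cong (- f zero +_) (neg-distrib-Σℤ (f ∘ suc)))

Σℤ-distrib-- : (f g : Fin n → ℤ) → Σℤ (λ i → f i - g i) ≡ Σℤ f - Σℤ g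
Σℤ-distrib-- f g =
  trans (Σℤ-distrib-+ f (λ i → - g i)) (cong (Σℤ f +_) (sym (neg-distrib-Σℤ g)))

*-distribˡ-Σℤ : ∀ c (f : Fin n → ℤ) → c * Σℤ f ≡ Σℤ (λ i → c * f i)
*-distribˡ-Σℤ {zero}  c f = *-zeroʳ c
*-distribˡ-Σℤ {suc n} c f =
  trans (*-distribˡ-+ c (f zero) _) (cong (c * f zero +_) (*-distribˡ-Σℤ c (f ∘ suc)))

*-distribʳ-Σℤ : ∀ c (f : Fin n → ℤ) → Σℤ f * c ≡ Σℤ (λ i → f i * c)
*-distribʳ-Σℤ c f =
  trans (*-comm (Σℤ f) c) (trans (*-distribˡ-Σℤ c f) (Σℤ-cong (λ i → *-comm c (f i))))

Σℤ-comm : (f : Fin m → Fin n → ℤ) →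
          Σℤ (λ i → Σℤ (λ j → f i j)) ≡ Σℤ (λ j → Σℤ (λ i → f i j))
Σℤ-comm {zero}  {n} f = sym (Σℤ-zero {n} (λ _ → refl))
Σℤ-comm {suc m}     f = trans (cong (Σℤ (f zero) +_) (Σℤ-comm (f ∘ suc)))
                              (sym (Σℤ-distrib-+ (f zero) _))

Σℤ-split : ∀ m (f : Fin (m ℕ.+ n) → ℤ) →
           Σℤ f ≡ Σℤ (λ i → f (i ↑ˡ n)) + Σℤ (λ i → f (m ↑ʳ i))
Σℤ-split zero    f = sym (+-identityˡ _)
Σℤ-split (suc m) f =
  trans (cong (f zero +_) (Σℤ-split m (f ∘ suc))) (sym (+-assoc (f zero) _ _))

_+ᵥ_ : Row n → Row n → Row n
(u +ᵥ v) i = u i + v i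

_-ᵥ_ : Row n → Row n → Row n
(u -ᵥ v) i = u i - v i

⊙-cong : {p p′ : Row m} (A : Mat m n) → p ≋ p′ → (p ⊙ A) ≋ (p′ ⊙ A)
⊙-cong A p≋p′ j = Σℤ-cong (λ t → cong (_* A t j) (p≋p′ t))

⊙-zeroˡ : (A : Mat m n) → (zeroVec ⊙ A) ≋ zeroVec
⊙-zeroˡ {m} A j = Σℤ-zero {m} (λ _ → refl)

⊙-distribʳ-+ : (p p′ : Row m) (A : Mat m n) → ((p +ᵥ p′) ⊙ A) ≋ ((p ⊙ A) +ᵥ (p′ ⊙ A))
⊙-distribʳ-+ p p′ A j =
  trans (Σℤ-cong (λ t → *-distribʳ-+ (A t j) (p t) (p′ t)))
        (Σℤ-distrib-+ (λ t → p t * A t j) (λ t → p′ t * A t j))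

⊙-distribʳ-- : (p p′ : Row m) (A : Mat m n) → ((p -ᵥ p′) ⊙ A) ≋ ((p ⊙ A) -ᵥ (p′ ⊙ A))
⊙-distribʳ-- p p′ A j =
  trans (Σℤ-cong (λ t → distrib (p t) (p′ t) (A t j)))
        (Σℤ-distrib-- (λ t → p t * A t j) (λ t → p′ t * A t j))
  where
  distrib : ∀ a b c → (a - b) * c ≡ a * c - b * c
  distrib = solve-∀

⊙-·col-assoc : (x : Row m) (B : Mat m n) (w : Fin n → ℤ) →
               Σℤ (λ s → (x ⊙ B) s * w s) ≡ Σℤ (λ t → x t * (B ·col w) t)
⊙-·col-assoc x B w = begin
  Σℤ (λ s → (x ⊙ B) s * w s)
    ≡⟨ Σℤ-cong (λ s → *-distribʳ-Σℤ (w s) (λ t → x t * B t s)) ⟩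
  Σℤ (λ s → Σℤ (λ t → x t * B t s * w s))
    ≡⟨ Σℤ-cong (λ s → Σℤ-cong (λ t → *-assoc (x t) (B t s) (w s))) ⟩
  Σℤ (λ s → Σℤ (λ t → x t * (B t s * w s)))
    ≡⟨ Σℤ-comm (λ s t → x t * (B t s * w s)) ⟩
  Σℤ (λ t → Σℤ (λ s → x t * (B t s * w s)))
    ≡⟨ Σℤ-cong (λ t → *-distribˡ-Σℤ (x t) (λ s → B t s * w s)) ⟨
  Σℤ (λ t → x t * (B ·col w) t)
    ∎

⊙-assoc : (p : Row k) (A : Mat k m) (B : Mat m n) → (p ⊙ (A ⊗ B)) ≋ ((p ⊙ A) ⊙ B)
⊙-assoc p A B j = sym (⊙-·col-assoc p A (λ s → B s j))

⊙-stack : (q : Row (ℓ ℕ.+ n)) (A : Mat ℓ m) (B : Mat n m) →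
          (q ⊙ stack A B) ≋ (((q ∘ (_↑ˡ n)) ⊙ A) +ᵥ ((q ∘ (ℓ ↑ʳ_)) ⊙ B))
⊙-stack {ℓ} {n} q A B j = trans (Σℤ-split ℓ (λ t → q t * stack A B t j))
  (cong₂ _+_ (Σℤ-cong (λ i → cong (λ row → q (i ↑ˡ n) * row j) (lookup-++ˡ A B i)))
             (Σℤ-cong (λ i → cong (λ row → q (ℓ ↑ʳ i) * row j) (lookup-++ʳ A B i))))

laplace : (u h : Fin n → ℤ) → ℤ
laplace u h = Σℤ (λ j → sign (toℕ j) * (u j * h j))

minor : Mat (suc m) (suc n) → Fin (suc n) → Mat m n
minor A j i k = A (suc i) (punchIn j k)

sign-suc : ∀ k → sign (suc k) ≡ - sign k
sign-suc zero          = refl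
sign-suc (suc zero)    = refl
sign-suc (suc (suc k)) = sign-suc k

laplace-congʳ : (u : Fin n → ℤ) {h h′ : Fin n → ℤ} → h ≋ h′ → laplace u h ≡ laplace u h′
laplace-congʳ u h≋h′ = Σℤ-cong (λ j → cong (λ a → sign (toℕ j) * (u j * a)) (h≋h′ j))

laplace-zeroˡ : {u : Fin n → ℤ} (h : Fin n → ℤ) → u ≋ zeroVec → laplace u h ≡ 0ℤ
laplace-zeroˡ h u≋0 = Σℤ-zero (λ j →
  trans (cong (λ a → sign (toℕ j) * (a * h j)) (u≋0 j)) (*-zeroʳ (sign (toℕ j))))

laplace-zeroʳ : (u : Fin n → ℤ) {h : Fin n → ℤ} → h ≋ zeroVec → laplace u h ≡ 0ℤ
laplace-zeroʳ u h≋0 = Σℤ-zero (λ j →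
  trans (cong (λ a → sign (toℕ j) * (u j * a)) (h≋0 j))
        (trans (cong (sign (toℕ j) *_) (*-zeroʳ (u j))) (*-zeroʳ (sign (toℕ j)))))

laplace-suc : (u h : Fin (suc n) → ℤ) →
              laplace u h ≡ u zero * h zero - laplace (u ∘ suc) (h ∘ suc)
laplace-suc u h = cong₂ _+_ (*-identityˡ (u zero * h zero)) (begin
  Σℤ (λ j → sign (suc (toℕ j)) * term j)  ≡⟨ Σℤ-cong (λ j → cong (_* term j) (sign-suc (toℕ j))) ⟩
  Σℤ (λ j → - sign (toℕ j) * term j)      ≡⟨ Σℤ-cong (λ j → neg-distribˡ-* (sign (toℕ j)) (term j)) ⟨
  Σℤ (λ j → - (sign (toℕ j) * term j))    ≡⟨ neg-distrib-Σℤ (λ j → sign (toℕ j) * term j) ⟨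
  - laplace (u ∘ suc) (h ∘ suc)           ∎)
  where
  term : Fin _ → ℤ
  term j = u (suc j) * h (suc j)

laplace-linearʳ : (u h h′ : Fin n → ℤ) (a : ℤ) →
                  laplace u (λ j → a * h j - h′ j) ≡ a * laplace u h - laplace u h′
laplace-linearʳ u h h′ a = begin
  laplace u (λ j → a * h j - h′ j)        ≡⟨ Σℤ-cong (λ j → distrib (sign (toℕ j)) (u j) (h j) (h′ j) a) ⟩
  Σℤ (λ j → a * term h j - term h′ j)     ≡⟨ Σℤ-distrib-- (λ j → a * term h j) (term h′) ⟩
  Σℤ (λ j → a * term h j) - laplace u h′  ≡⟨ cong (_- laplace u h′) (*-distribˡ-Σℤ a (term h)) ⟨
  a * laplace u h - laplace u h′          ∎
  where
  term : (Fin _ → ℤ) → Fin _ → ℤ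
  term g j = sign (toℕ j) * (u j * g j)
  distrib : ∀ s x y z a → s * (x * (a * y - z)) ≡ a * (s * (x * y)) - s * (x * z)
  distrib = solve-∀

laplace-⊙ : (x : Row m) (B : Mat m n) (h : Fin n → ℤ) →
            laplace (x ⊙ B) h ≡ Σℤ (λ t → x t * laplace (B t) h)
laplace-⊙ x B h = begin
  laplace (x ⊙ B) h                            ≡⟨ laplace-as-dot (x ⊙ B) ⟩
  Σℤ (λ s → (x ⊙ B) s * signed s)              ≡⟨ ⊙-·col-assoc x B signed ⟩
  Σℤ (λ t → x t * Σℤ (λ s → B t s * signed s)) ≡⟨ Σℤ-cong (λ t → cong (x t *_) (laplace-as-dot (B t))) ⟨
  Σℤ (λ t → x t * laplace (B t) h)             ∎
  where
  signed : Fin _ → ℤ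
  signed s = sign (toℕ s) * h s
  rearrange : ∀ a b c → a * (b * c) ≡ b * (a * c)
  rearrange = solve-∀
  laplace-as-dot : (u : Fin _ → ℤ) → laplace u h ≡ Σℤ (λ s → u s * signed s)
  laplace-as-dot u = Σℤ-cong (λ s → rearrange (sign (toℕ s)) (u s) (h s))

Extensional : ((Fin m → Fin n) → ℤ) → Set
Extensional g = g Preserves _≗_ ⟶ _≡_

laplace₂ : ((Fin m → Fin (2 ℕ.+ m)) → ℤ) → (u v : Fin (2 ℕ.+ m) → ℤ) → ℤ
laplace₂ g u v = laplace u (λ j → laplace (v ∘ punchIn j) (λ k → g (punchIn j ∘ punchIn k)))

laplace∖₀ : ((Fin (suc m) → Fin (3 ℕ.+ m)) → ℤ) → (Fin (3 ℕ.+ m) → ℤ) → ℤ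
laplace∖₀ g v = laplace (v ∘ suc) (λ k → g (suc ∘ punchIn k))

keepCol₀ : ((Fin (suc m) → Fin (suc n)) → ℤ) → (Fin m → Fin n) → ℤ
keepCol₀ g f = g (lift 1 f)

keepCol₀-ext : {g : (Fin (suc m) → Fin (suc n)) → ℤ} → Extensional g → Extensional (keepCol₀ g)
keepCol₀-ext g-ext f≗f′ = g-ext λ { zero → refl ; (suc i) → cong suc (f≗f′ i) }

punchIn-suc-∘ : (j : Fin (2 ℕ.+ n)) (k : Fin (suc n)) →
                punchIn (suc j) ∘ punchIn (suc k) ≗ lift 1 (punchIn j ∘ punchIn k)
punchIn-suc-∘ j k zero    = refl
punchIn-suc-∘ j k (suc l) = refl

-- Split the double expansion according to which row uses column 0: u, v, or neither.
laplace₂-suc : (g : (Fin (suc m) → Fin (3 ℕ.+ m)) → ℤ) → Extensional g → ∀ u v →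
               laplace₂ g u v ≡ u zero * laplace∖₀ g v - v zero * laplace∖₀ g u
                                + laplace₂ (keepCol₀ g) (u ∘ suc) (v ∘ suc)
laplace₂-suc g g-ext u v = begin
  laplace₂ g u v                                       ≡⟨ laplace-suc u H ⟩
  a - laplace (u ∘ suc) (H ∘ suc)                      ≡⟨ cong (_-_ a) (laplace-congʳ (u ∘ suc) H-suc) ⟩
  a - laplace (u ∘ suc) (λ j → v zero * g (suc ∘ punchIn j) - H↑ j)
    ≡⟨ cong (_-_ a) (laplace-linearʳ (u ∘ suc) (λ j → g (suc ∘ punchIn j)) H↑ (v zero)) ⟩
  a - (b - laplace₂ (keepCol₀ g) (u ∘ suc) (v ∘ suc))  ≡⟨ sub-sub a b _ ⟩
  a - b + laplace₂ (keepCol₀ g) (u ∘ suc) (v ∘ suc)    ∎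
  where
  a = u zero * laplace∖₀ g v
  b = v zero * laplace∖₀ g u
  H : Fin (3 ℕ.+ _) → ℤ
  H j = laplace (v ∘ punchIn j) (λ k → g (punchIn j ∘ punchIn k))
  H↑ : Fin (2 ℕ.+ _) → ℤ
  H↑ j = laplace (v ∘ suc ∘ punchIn j) (λ k → keepCol₀ g (punchIn j ∘ punchIn k))
  H-suc : ∀ j → H (suc j) ≡ v zero * g (suc ∘ punchIn j) - H↑ j
  H-suc j = trans (laplace-suc (v ∘ punchIn (suc j)) (λ k → g (punchIn (suc j) ∘ punchIn k)))
                  (cong (_-_ (v zero * g (suc ∘ punchIn j)))
                        (laplace-congʳ (v ∘ suc ∘ punchIn j) (λ k → g-ext (punchIn-suc-∘ j k))))
  sub-sub : ∀ a b c → a - (b - c) ≡ a - b + c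
  sub-sub = solve-∀

laplace₂-antisym : (g : (Fin m → Fin (2 ℕ.+ m)) → ℤ) → Extensional g →
                   ∀ u v → laplace₂ g u v ≡ - laplace₂ g v u
laplace₂-antisym {zero} g g-ext u v =
  det₂-antisym (u zero) (u (suc zero)) (v zero) (v (suc zero)) (g-ext λ ())
  where
  -- Both sides are laplace₂ unfolded on two columns; x and y are g at the two (equal) empty selections.
  det₂-antisym : ∀ a b c d {x y} → x ≡ y →
    1ℤ * (a * (1ℤ * (d * x) + 0ℤ)) + (- 1ℤ * (b * (1ℤ * (c * y) + 0ℤ)) + 0ℤ)
    ≡ - (1ℤ * (c * (1ℤ * (b * x) + 0ℤ)) + (- 1ℤ * (d * (1ℤ * (a * y) + 0ℤ)) + 0ℤ))
  det₂-antisym a b c d {x} refl = identity a b c d x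
    where
    identity : ∀ a b c d x →
      1ℤ * (a * (1ℤ * (d * x) + 0ℤ)) + (- 1ℤ * (b * (1ℤ * (c * x) + 0ℤ)) + 0ℤ)
      ≡ - (1ℤ * (c * (1ℤ * (b * x) + 0ℤ)) + (- 1ℤ * (d * (1ℤ * (a * x) + 0ℤ)) + 0ℤ))
    identity = solve-∀
laplace₂-antisym {suc m} g g-ext u v = begin
  laplace₂ g u v                                        ≡⟨ laplace₂-suc g g-ext u v ⟩
  a - b + laplace₂ (keepCol₀ g) (u ∘ suc) (v ∘ suc)
    ≡⟨ cong (a - b +_) (laplace₂-antisym (keepCol₀ g) (keepCol₀-ext g-ext) (u ∘ suc) (v ∘ suc)) ⟩
  a - b + - laplace₂ (keepCol₀ g) (v ∘ suc) (u ∘ suc)   ≡⟨ swap-neg a b _ ⟩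
  - (b - a + laplace₂ (keepCol₀ g) (v ∘ suc) (u ∘ suc)) ≡⟨ cong -_ (laplace₂-suc g g-ext v u) ⟨
  - laplace₂ g v u                                      ∎
  where
  a = u zero * laplace∖₀ g v
  b = v zero * laplace∖₀ g u
  swap-neg : ∀ a b c → a - b + - c ≡ - (b - a + c)
  swap-neg = solve-∀

det-cong : {A B : Mat n n} → (∀ i j → A i j ≡ B i j) → det A ≡ det B
det-cong {zero}  A≡B = refl
det-cong {suc n} A≡B = Σℤ-cong (λ j → cong₂ (λ a d → sign (toℕ j) * (a * d))
                                        (A≡B zero j) (det-cong (λ i k → A≡B (suc i) (punchIn j k))))

swap₀₁ : Mat (2 ℕ.+ m) n → Mat (2 ℕ.+ m) n
swap₀₁ A zero          = A (suc zero)
swap₀₁ A (suc zero)    = A zero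
swap₀₁ A (suc (suc i)) = A (suc (suc i))

-- Unfolding det twice gives det A = laplace₂ lowerDet (A zero) (A (suc zero)) definitionally.
det-swap₀₁ : (A : Mat (2 ℕ.+ m) (2 ℕ.+ m)) → det A ≡ - det (swap₀₁ A)
det-swap₀₁ A = laplace₂-antisym lowerDet lowerDet-ext (A zero) (A (suc zero))
  where
  lowerDet : (Fin _ → Fin _) → ℤ
  lowerDet f = det (λ i l → A (suc (suc i)) (f l))
  lowerDet-ext : Extensional lowerDet
  lowerDet-ext f≗f′ = det-cong (λ i l → cong (A (suc (suc i))) (f≗f′ l))

i≡-i⇒i≡0 : ∀ i → i ≡ - i → i ≡ 0ℤ
i≡-i⇒i≡0 +0       _  = refl
i≡-i⇒i≡0 +[1+ _ ] ()
i≡-i⇒i≡0 -[1+ _ ] ()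

det-repeated-row : (A : Mat (suc n) (suc n)) (r : Fin n) → A zero ≋ A (suc r) → det A ≡ 0ℤ
det-repeated-row A zero row₀≋row₁ =
  i≡-i⇒i≡0 (det A) (trans (det-swap₀₁ A) (cong -_ (det-cong swapped≡A)))
  where
  swapped≡A : ∀ i k → swap₀₁ A i k ≡ A i k
  swapped≡A zero          k = sym (row₀≋row₁ k)
  swapped≡A (suc zero)    k = row₀≋row₁ k
  swapped≡A (suc (suc i)) k = refl
det-repeated-row A (suc r) row₀≋row₂₊ᵣ =
  trans (det-swap₀₁ A) (cong -_ (laplace-zeroʳ (A (suc zero)) (λ j →
    det-repeated-row (minor (swap₀₁ A) j) r (λ k → row₀≋row₂₊ᵣ (punchIn j k)))))

⊙-trivial-kernel : (A : Mat n n) → Nonsingular A → (x : Row n) → (x ⊙ A) ≋ zeroVec → x ≋ zeroVec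
⊙-trivial-kernel {zero}  A det≢0 x xA≋0 ()
⊙-trivial-kernel {suc n} A det≢0 x xA≋0 = x≋0
  where
  cofactors : Fin (suc n) → ℤ
  cofactors j = det (minor A j)

  -- A (suc r) ∷ tail A, whose determinant is laplace (A (suc r)) cofactors, repeats row suc r.
  other-rows : ∀ r → x (suc r) * laplace (A (suc r)) cofactors ≡ 0ℤ
  other-rows r = trans (cong (x (suc r) *_) (det-repeated-row (A (suc r) ∷ tail A) r (λ _ → refl)))
                       (*-zeroʳ (x (suc r)))

  x₀*det≡0 : x zero * det A ≡ 0ℤ
  x₀*det≡0 = begin
    x zero * det A                            ≡⟨ +-identityʳ (x zero * det A) ⟨
    x zero * det A + 0ℤ                       ≡⟨ cong (x zero * det A +_) (Σℤ-zero other-rows) ⟨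
    Σℤ (λ t → x t * laplace (A t) cofactors)  ≡⟨ laplace-⊙ x A cofactors ⟨
    laplace (x ⊙ A) cofactors                 ≡⟨ laplace-zeroˡ cofactors xA≋0 ⟩
    0ℤ                                        ∎

  x₀≡0 : x zero ≡ 0ℤ
  x₀≡0 with i*j≡0⇒i≡0∨j≡0 (x zero) x₀*det≡0
  ... | inj₁ x₀≡0  = x₀≡0
  ... | inj₂ det≡0 = contradiction det≡0 det≢0

  tail-kernel : ∀ j → ((x ∘ suc) ⊙ minor A j) ≋ zeroVec
  tail-kernel j k = begin
    rest                               ≡⟨ +-identityˡ rest ⟨
    0ℤ * A zero (punchIn j k) + rest   ≡⟨ cong (λ a → a * A zero (punchIn j k) + rest) x₀≡0 ⟨
    (x ⊙ A) (punchIn j k)              ≡⟨ xA≋0 (punchIn j k) ⟩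
    0ℤ                                 ∎
    where
    rest = ((x ∘ suc) ⊙ minor A j) k

  -- A nonzero later coordinate would make every minor singular by induction, hence A too.
  x≋0 : x ≋ zeroVec
  x≋0 zero    = x₀≡0
  x≋0 (suc r) = decidable-stable (x (suc r) ≟ 0ℤ) λ xᵣ≢0 →
    det≢0 (laplace-zeroʳ (A zero) λ j → decidable-stable (det (minor A j) ≟ 0ℤ) λ minor≢0 →
      xᵣ≢0 (⊙-trivial-kernel (minor A j) minor≢0 (x ∘ suc) (tail-kernel j) r))

⊙-cancelʳ : {p p′ : Row n} (A : Mat n n) → Nonsingular A → (p ⊙ A) ≋ (p′ ⊙ A) → p ≋ p′
⊙-cancelʳ {p = p} {p′} A det≢0 pA≋p′A i = i-j≡0⇒i≡j (p i) (p′ i)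
  (⊙-trivial-kernel A det≢0 (p -ᵥ p′)
    (λ j → trans (⊙-distribʳ-- p p′ A j) (i≡j⇒i-j≡0 (pA≋p′A j))) i)

InR-⊗ : (M : Mat ℓ m) (H : Mat n n) (F : Mat n m) (p : Row n) →
        InR M (H ⊗ F) p ⇔ InR M F (p ⊙ H)
InR-⊗ M H F p = mk⇔ (λ (q , pHF≋qM) → q , λ j → trans (sym (⊙-assoc p H F j)) (pHF≋qM j))
                    (λ (q , pHF≋qM) → q , λ j → trans (⊙-assoc p H F j) (pHF≋qM j))

InRowLattice-⊗ʳ : (A B : Mat n n) {p : Row n} → InRowLattice (A ⊗ B) p → InRowLattice B p
InRowLattice-⊗ʳ A B (u , p≋uAB) = u ⊙ A , λ j → trans (p≋uAB j) (⊙-assoc u A B j)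

InRowLattice-⊙ : (A B : Mat n n) → Nonsingular B → (p : Row n) →
                 InRowLattice (A ⊗ B) (p ⊙ B) ⇔ InRowLattice A p
InRowLattice-⊙ A B det≢0 p = mk⇔
  (λ (u , pB≋uAB) → u , ⊙-cancelʳ B det≢0 (λ j → trans (pB≋uAB j) (⊙-assoc u A B j)))
  (λ (u , p≋uA) → u , λ j → trans (⊙-cong B p≋uA j) (sym (⊙-assoc u A B j)))

InRowLattice-shift : (H : Mat n n) (p q : Row n) →
                     InRowLattice H (p -ᵥ (q ⊙ H)) → InRowLattice H p
InRowLattice-shift H p q (u , p-qH≋uH) = q +ᵥ u , λ i → begin
  p i                            ≡⟨ add-sub (p i) ((q ⊙ H) i) ⟩
  (q ⊙ H) i + (p i - (q ⊙ H) i)  ≡⟨ cong ((q ⊙ H) i +_) (p-qH≋uH i) ⟩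
  (q ⊙ H) i + (u ⊙ H) i          ≡⟨ ⊙-distribʳ-+ q u H i ⟨
  ((q +ᵥ u) ⊙ H) i               ∎
  where
  add-sub : ∀ a b → a ≡ b + (a - b)
  add-sub = solve-∀

InR-stack⁻ : (M : Mat ℓ m) (H : Mat n n) (F : Mat n m) (p : Row n) →
             InR (stack M (H ⊗ F)) F p → Σ (Row n) (λ q → InR M F (p -ᵥ (q ⊙ H)))
InR-stack⁻ {ℓ} {n = n} M H F p (q , pF≋qS) = q₂ , q₁ , λ j → begin
  ((p -ᵥ (q₂ ⊙ H)) ⊙ F) j                          ≡⟨ ⊙-distribʳ-- p (q₂ ⊙ H) F j ⟩
  (p ⊙ F) j - ((q₂ ⊙ H) ⊙ F) j                     ≡⟨ cong₂ _-_ (pF≋qS j) (sym (⊙-assoc q₂ H F j)) ⟩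
  (q ⊙ stack M (H ⊗ F)) j - (q₂ ⊙ (H ⊗ F)) j       ≡⟨ cong (_- (q₂ ⊙ (H ⊗ F)) j) (⊙-stack q M (H ⊗ F) j) ⟩
  (q₁ ⊙ M) j + (q₂ ⊙ (H ⊗ F)) j - (q₂ ⊙ (H ⊗ F)) j ≡⟨ add-sub-cancel ((q₁ ⊙ M) j) _ ⟩
  (q₁ ⊙ M) j                                       ∎
  where
  q₁ : Row ℓ
  q₁ = q ∘ (_↑ˡ n)
  q₂ : Row n
  q₂ = q ∘ (ℓ ↑ʳ_)
  add-sub-cancel : ∀ a b → a + b - b ≡ a
  add-sub-cancel = solve-∀

InR-stack⁺ : (M : Mat ℓ m) (H : Mat n n) (F : Mat n m) {p : Row n} →
             InRowLattice H p → InR (stack M (H ⊗ F)) F p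
InR-stack⁺ {ℓ} {n = n} M H F {p} (u , p≋uH) = q , λ j → begin
  (p ⊙ F) j                                                 ≡⟨ ⊙-cong F p≋uH j ⟩
  ((u ⊙ H) ⊙ F) j                                           ≡⟨ ⊙-assoc u H F j ⟨
  (u ⊙ (H ⊗ F)) j                                           ≡⟨ +-identityˡ _ ⟨
  0ℤ + (u ⊙ (H ⊗ F)) j
    ≡⟨ cong₂ _+_ (trans (⊙-cong M (lookup-++ˡ (zeroVec {ℓ}) u) j) (⊙-zeroˡ M j))
                 (⊙-cong (H ⊗ F) (lookup-++ʳ (zeroVec {ℓ}) u) j) ⟨
  ((q ∘ (_↑ˡ n)) ⊙ M) j + ((q ∘ (ℓ ↑ʳ_)) ⊙ (H ⊗ F)) j        ≡⟨ ⊙-stack q M (H ⊗ F) j ⟨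
  (q ⊙ stack M (H ⊗ F)) j                                   ∎
  where
  q : Row (ℓ ℕ.+ n)
  q = zeroVec {ℓ} ++ u

mkIsBasisR : (M : Mat ℓ m) (F : Mat n m) (P : Mat n n) → Nonsingular P →
             (∀ p → InR M F p ⇔ InRowLattice P p) → IsBasisR M F P
mkIsBasisR M F P det≢0 R⇔L = det≢0 , λ p → Equivalence.to (R⇔L p) , Equivalence.from (R⇔L p)

theorem23 : ∀ {ℓ m n} (M : Mat ℓ m) (F : Mat n m) (H₁ H₂ : Mat n n) →
    FullColumnRank M → Nonsingular H₁ → Nonsingular H₂ →
    IsBasisR M F (H₂ ⊗ H₁) →
    IsBasisR (stack M (H₁ ⊗ F)) F H₁ × IsBasisR M (H₁ ⊗ F) H₂
theorem23 M F H₁ H₂ _ H₁-nonsingular H₂-nonsingular (_ , basis) =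
  mkIsBasisR (stack M (H₁ ⊗ F)) F H₁ H₁-nonsingular
    (λ p → mk⇔ (stacked⇒lattice p) (InR-stack⁺ M H₁ F)) ,
  mkIsBasisR M (H₁ ⊗ F) H₂ H₂-nonsingular
    (λ p → (InRowLattice-⊙ H₂ H₁ H₁-nonsingular p ⇔-∘ R⇔L (p ⊙ H₁)) ⇔-∘ InR-⊗ M H₁ F p)
  where
  R⇔L : ∀ p → InR M F p ⇔ InRowLattice (H₂ ⊗ H₁) p
  R⇔L p = mk⇔ (proj₁ (basis p)) (proj₂ (basis p))

  stacked⇒lattice : ∀ p → InR (stack M (H₁ ⊗ F)) F p → InRowLattice H₁ p
  stacked⇒lattice p p∈R =
    let q , p-qH₁∈R = InR-stack⁻ M H₁ F p p∈R
    in InRowLattice-shift H₁ p q (InRowLattice-⊗ʳ H₂ H₁ (proj₁ (basis (p -ᵥ (q ⊙ H₁))) p-qH₁∈R))
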